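{- For every odd integer $n\ge 3$, $\gamma_I(C_2 \square C_n) = n+1$.
   Context: For an integer $k\ge 2$, $C_k$ denotes the directed cycle with vertex set $\{1,2,\dots,k\}$ and arcs $i\rightarrow i+1$ (indices taken modulo $k$); in particular $C_2$ has arcs $1\rightarrow 2$ and $2\rightarrow 1$. For digraphs $D_1=(V_1,A_1)$ and $D_2=(V_2,A_2)$, the cartesian product $D_1\square D_2$ is the digraph with vertex set $V_1\times V_2$ in which $(x_1,x_2)\rightarrow(y_1,y_2)$ is an arc if and only if either ($x_1=y_1$ and $x_2\rightarrow y_2$ in $D_2$) or ($x_1\rightarrow y_1$ in $D_1$ and $x_2=y_2$). An Italian dominating function on a digraph $D$ is a function $f:V(D)\to\{0,1,2\}$ such that every vertex $v$ with $f(v)=0$ has at least two in-neighbors $u$ with $f(u)=1$ or at least one in-neighbor $w$ with $f(w)=2$ (an in-neighbor of $v$ is a vertex $u$ with $u\rightarrow v$). Its weight is $\sum_{u\in V(D)} f(u)$, and the Italian domination number $\gamma_I(D)$ is the minimum weight of an Italian dominating function on $D$. -}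

module Defs where

open import Data.Nat using (ℕ; zero; suc; _+_; _≤_; NonZero)
open import Data.Fin using (Fin; toℕ)
open import Data.List using (List; map; allFin; cartesianProduct)
open import Data.Nat.ListAction using (sum)
open import Data.Product using (_×_; _,_; Σ; ∃; ∃-syntax; proj₁; proj₂)
open import Data.Sum using (_⊎_)
open import Relation.Binary.PropositionalEquality using (_≡_; _≢_)
open import Data.Nat.DivMod using (_%_)

-- A finite digraph: a vertex type, an explicit duplicate-free list of all
-- vertices (used to compute weights), and an arc relation.
record Digraph : Set₁ where
  field
    V     : Set
    verts : List V
    _⇒_   : V → V → Set

open Digraph public

-- Directed cycle C_n on vertices Fin n (vertex i here stands for i+1 in the
-- paper), arcs i → i+1 (mod n). The theorem only uses n ≥ 2.
cycleArc : (n : ℕ) → .{{NonZero n}} → Fin n → Fin n → Set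
cycleArc n i j = toℕ j ≡ suc (toℕ i) % n

Cyc : (n : ℕ) → .{{NonZero n}} → Digraph
Cyc n = record { V = Fin n ; verts = allFin n ; _⇒_ = cycleArc n }

_□_ : Digraph → Digraph → Digraph
D₁ □ D₂ = record
  { V = V D₁ × V D₂
  ; verts = cartesianProduct (verts D₁) (verts D₂)
  ; _⇒_ = λ x y →
      (proj₁ x ≡ proj₁ y × (_⇒_ D₂) (proj₂ x) (proj₂ y))
      ⊎ ((_⇒_ D₁) (proj₁ x) (proj₁ y) × proj₂ x ≡ proj₂ y)
  }

IsItalianDominating : (D : Digraph) → (V D → ℕ) → Set
IsItalianDominating D f =
  (∀ v → f v ≤ 2) ×
  (∀ v → f v ≡ 0 →
     (∃[ u₁ ] ∃[ u₂ ] (u₁ ≢ u₂ × (_⇒_ D) u₁ v × (_⇒_ D) u₂ v × f u₁ ≡ 1 × f u₂ ≡ 1))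
     ⊎ (∃[ w ] ((_⇒_ D) w v × f w ≡ 2)))

weight : (D : Digraph) → (V D → ℕ) → ℕ
weight D f = sum (map f (verts D))

ItalianDominationNumber : Digraph → ℕ → Set
ItalianDominationNumber D m =
  (Σ (V D → ℕ) λ f → IsItalianDominating D f × weight D f ≡ m) ×
  (∀ (f : V D → ℕ) → IsItalianDominating D f → m ≤ weight D f)

{-# OPTIONS --safe #-}
-- Write col c = f (0, c) + f (1, c) for the weight of column c of C₂ □ Cₙ. The only
-- in-neighbours of (a, c) are (1 - a, c) and (a, c - 1), so the Italian condition at the
-- two vertices of column c forces col (c - 1) + col c ≥ 2, and summing these n cyclic
-- pairs gives 2 · weight ≥ 2n. If every pair had weight exactly 2, no column could be
-- empty (an empty column forces weight 4 on its predecessor), so every column would have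
-- weight 1 and row 0 would alternate 0, 1 around the cycle, which is impossible for odd n.
-- Hence some pair has weight ≥ 3, and weight ≥ n + 1. The value n + 1 is attained by
-- putting 1 on the even columns of row 0, on the odd columns of row 1, and on (1, 0).
module Submission where

open import Defs
open import Data.Nat using (ℕ; zero; suc; _+_; _*_; _%_; _≤_; _<_; NonZero; z≤n; s≤s; _≟_)
open import Data.Nat.Properties
open import Data.Nat.DivMod using (m<n⇒m%n≡m; n%n≡0)
import Data.Nat.ListAction as List
open import Data.Nat.ListAction.Properties using (sum-++)
open import Data.Fin using (Fin; zero; suc; toℕ; fromℕ; inject₁)
open import Data.Fin.Patterns using (0F; 1F)
open import Data.Fin.Properties using (toℕ-injective; toℕ-fromℕ; toℕ-inject₁; toℕ<n; all?; ¬∀⟶∃¬)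
open import Data.List using (List; []; _∷_; _++_; map; tabulate; allFin; cartesianProduct)
open import Data.List.Properties using (map-++; map-∘; map-tabulate)
open import Data.Vec.Functional using (Vector; init; last)
open import Data.Product using (∃-syntax; _×_; _,_; proj₁; proj₂)
open import Data.Sum using (_⊎_; inj₁; inj₂)
open import Function using (_∘_; id)
open import Relation.Nullary using (yes; no; contradiction)
open import Relation.Binary.PropositionalEquality

open import Algebra.Properties.CommutativeMonoid.Sum +-0-commutativeMonoid
  using (sum; sum-syntax; sum-cong-≗; sum-init-last; ∑-distrib-+)

∑-const : ∀ n k → ∑[ i < n ] k ≡ n * k
∑-const zero    k = refl
∑-const (suc n) k = cong (k +_) (∑-const n k)

∑-mono-≤ : ∀ {n} {s t : Vector ℕ n} → (∀ i → s i ≤ t i) → sum s ≤ sum t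
∑-mono-≤ {zero}  s≤t = z≤n
∑-mono-≤ {suc n} s≤t = +-mono-≤ (s≤t zero) (∑-mono-≤ (s≤t ∘ suc))

∑-mono-< : ∀ {n} {s t : Vector ℕ n} → (∀ i → s i ≤ t i) → ∀ j → s j < t j → sum s < sum t
∑-mono-< s≤t zero    s₀<t₀ = +-mono-<-≤ s₀<t₀ (∑-mono-≤ (s≤t ∘ suc))
∑-mono-< s≤t (suc j) sⱼ<tⱼ = +-mono-≤-< (s≤t zero) (∑-mono-< (s≤t ∘ suc) j sⱼ<tⱼ)

sum-cartesianProduct : ∀ {A B : Set} (f : A × B → ℕ) (xs : List A) (ys : List B) →
  List.sum (map f (cartesianProduct xs ys)) ≡ List.sum (map (λ x → List.sum (map (λ y → f (x , y)) ys)) xs)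
sum-cartesianProduct f []       ys = refl
sum-cartesianProduct f (x ∷ xs) ys = begin
  List.sum (map f (map (x ,_) ys ++ cartesianProduct xs ys))
    ≡⟨ cong List.sum (map-++ f (map (x ,_) ys) _) ⟩
  List.sum (map f (map (x ,_) ys) ++ map f (cartesianProduct xs ys))
    ≡⟨ sum-++ (map f (map (x ,_) ys)) _ ⟩
  List.sum (map f (map (x ,_) ys)) + List.sum (map f (cartesianProduct xs ys))
    ≡⟨ cong₂ _+_ (cong List.sum (sym (map-∘ ys))) (sum-cartesianProduct f xs ys) ⟩
  List.sum (map (λ y → f (x , y)) ys) + List.sum (map (λ x → List.sum (map (λ y → f (x , y)) ys)) xs)
    ∎
  where open ≡-Reasoning

sum-tabulate : ∀ {n} (t : Vector ℕ n) → List.sum (tabulate t) ≡ sum t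
sum-tabulate {zero}  t = refl
sum-tabulate {suc n} t = cong (t zero +_) (sum-tabulate (t ∘ suc))

sum-allFin : ∀ {n} (t : Vector ℕ n) → List.sum (map t (allFin n)) ≡ sum t
sum-allFin t = trans (cong List.sum (map-tabulate id t)) (sum-tabulate t)

cyclicPred : ∀ {n} → Fin (suc n) → Fin (suc n)
cyclicPred {n} zero = fromℕ n
cyclicPred (suc i)  = inject₁ i

∑-cyclicPred : ∀ {n} (t : Vector ℕ (suc n)) → ∑[ i < suc n ] t (cyclicPred i) ≡ sum t
∑-cyclicPred t = begin
  last t + sum (init t) ≡⟨ +-comm (last t) _ ⟩
  sum (init t) + last t ≡⟨ sum-init-last t ⟨
  sum t                 ∎
  where open ≡-Reasoning

∑-cyclic-pairs : ∀ {n} (t : Vector ℕ (suc n)) → ∑[ i < suc n ] (t (cyclicPred i) + t i) ≡ 2 * sum t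
∑-cyclic-pairs {n} t = begin
  ∑[ i < suc n ] (t (cyclicPred i) + t i)      ≡⟨ ∑-distrib-+ (t ∘ cyclicPred) t ⟩
  ∑[ i < suc n ] t (cyclicPred i) + sum t      ≡⟨ cong (_+ sum t) (∑-cyclicPred t) ⟩
  sum t + sum t                                ≡⟨ cong (sum t +_) (+-identityʳ (sum t)) ⟨
  2 * sum t                                    ∎
  where open ≡-Reasoning

alternating⇒even : ∀ {n} (r : Vector ℕ (suc n)) → (∀ i → r (cyclicPred i) + r i ≡ 1) → 2 * sum r ≡ suc n
alternating⇒even {n} r alternating = begin
  2 * sum r                                ≡⟨ ∑-cyclic-pairs r ⟨
  ∑[ i < suc n ] (r (cyclicPred i) + r i)  ≡⟨ sum-cong-≗ alternating ⟩
  ∑[ i < suc n ] 1                         ≡⟨ ∑-const (suc n) 1 ⟩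
  suc n * 1                                ≡⟨ *-identityʳ (suc n) ⟩
  suc n                                    ∎
  where open ≡-Reasoning

cycleArc-cyclicPred : ∀ {n} (j : Fin (suc n)) → cycleArc (suc n) (cyclicPred j) j
cycleArc-cyclicPred {n} zero = sym (begin
  suc (toℕ (fromℕ n)) % suc n ≡⟨ cong (λ m → suc m % suc n) (toℕ-fromℕ n) ⟩
  suc n % suc n               ≡⟨ n%n≡0 (suc n) ⟩
  0                           ∎)
  where open ≡-Reasoning
cycleArc-cyclicPred {n} (suc i) = sym (begin
  suc (toℕ (inject₁ i)) % suc n ≡⟨ cong (λ m → suc m % suc n) (toℕ-inject₁ i) ⟩
  suc (toℕ i) % suc n           ≡⟨ m<n⇒m%n≡m (s≤s (toℕ<n i)) ⟩
  suc (toℕ i)                   ∎)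
  where open ≡-Reasoning

cycleArc⇒cyclicPred : ∀ {n} {i j : Fin (suc n)} → cycleArc (suc n) i j → i ≡ cyclicPred j
cycleArc⇒cyclicPred {n} {i} {j} arc with m<1+n⇒m<n∨m≡n (toℕ<n i)
... | inj₁ i<n = from-suc j (trans arc (m<n⇒m%n≡m (s≤s i<n)))
  where
  from-suc : ∀ j → toℕ j ≡ suc (toℕ i) → i ≡ cyclicPred j
  from-suc (suc k) k≡i = toℕ-injective (trans (suc-injective (sym k≡i)) (sym (toℕ-inject₁ k)))
... | inj₂ i≡n = from-zero j (trans arc (trans (cong (λ m → suc m % suc n) i≡n) (n%n≡0 (suc n))))
  where
  from-zero : ∀ j → toℕ j ≡ 0 → i ≡ cyclicPred j
  from-zero zero _ = toℕ-injective (trans i≡n (sym (toℕ-fromℕ n)))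

italian-zero⇒≥2 : ∀ (D : Digraph) {f v w₁ w₂} → (∀ {u} → _⇒_ D u v → u ≡ w₁ ⊎ u ≡ w₂) →
                  IsItalianDominating D f → f v ≡ 0 → 2 ≤ f w₁ + f w₂
italian-zero⇒≥2 D in-neighbour (_ , dominated) fv≡0 with dominated _ fv≡0
... | inj₂ (w , arc , fw≡2) with in-neighbour arc
...   | inj₁ refl = ≤-trans (≤-reflexive (sym fw≡2)) (m≤m+n _ _)
...   | inj₂ refl = ≤-trans (≤-reflexive (sym fw≡2)) (m≤n+m _ _)
italian-zero⇒≥2 D in-neighbour (_ , dominated) fv≡0
    | inj₁ (u₁ , u₂ , u₁≢u₂ , arc₁ , arc₂ , fu₁≡1 , fu₂≡1)
    with in-neighbour arc₁ | in-neighbour arc₂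
... | inj₁ refl | inj₁ refl = contradiction refl u₁≢u₂
... | inj₁ refl | inj₂ refl = ≤-reflexive (sym (cong₂ _+_ fu₁≡1 fu₂≡1))
... | inj₂ refl | inj₁ refl = ≤-reflexive (sym (cong₂ _+_ fu₂≡1 fu₁≡1))
... | inj₂ refl | inj₂ refl = contradiction refl u₁≢u₂

module _ {m n : ℕ} where

  private
    Torus : Digraph
    Torus = Cyc (suc m) □ Cyc (suc n)

  □-in-neighbour : ∀ {u a c} → _⇒_ Torus u (a , c) → u ≡ (cyclicPred a , c) ⊎ u ≡ (a , cyclicPred c)
  □-in-neighbour (inj₁ (refl , arc)) = inj₂ (cong (_ ,_) (cycleArc⇒cyclicPred arc))
  □-in-neighbour (inj₂ (arc , refl)) = inj₁ (cong (_, _) (cycleArc⇒cyclicPred arc))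

  □-arc-cyclicPred₁ : ∀ a c → _⇒_ Torus (cyclicPred a , c) (a , c)
  □-arc-cyclicPred₁ a c = inj₂ (cycleArc-cyclicPred a , refl)

  □-arc-cyclicPred₂ : ∀ a c → _⇒_ Torus (a , cyclicPred c) (a , c)
  □-arc-cyclicPred₂ a c = inj₁ (refl , cycleArc-cyclicPred c)

  □-italian-zero : ∀ {f} → IsItalianDominating Torus f →
                   ∀ a c → f (a , c) ≡ 0 → 2 ≤ f (cyclicPred a , c) + f (a , cyclicPred c)
  □-italian-zero italian a c = italian-zero⇒≥2 Torus □-in-neighbour italian

weight-C₂□C : ∀ {n} (f : Fin 2 × Fin (suc n) → ℕ) →
              weight (Cyc 2 □ Cyc (suc n)) f ≡ ∑[ c < suc n ] (f (0F , c) + f (1F , c))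
weight-C₂□C {n} f = begin
  weight (Cyc 2 □ Cyc (suc n)) f
    ≡⟨ sum-cartesianProduct f (allFin 2) (allFin (suc n)) ⟩
  row 0F + (row 1F + 0)
    ≡⟨ cong₂ _+_ (sum-allFin (λ c → f (0F , c))) (trans (+-identityʳ (row 1F)) (sum-allFin (λ c → f (1F , c)))) ⟩
  ∑[ c < suc n ] f (0F , c) + ∑[ c < suc n ] f (1F , c)
    ≡⟨ ∑-distrib-+ (λ c → f (0F , c)) (λ c → f (1F , c)) ⟨
  ∑[ c < suc n ] (f (0F , c) + f (1F , c))
    ∎
  where
  open ≡-Reasoning
  row : Fin 2 → ℕ
  row a = List.sum (map (λ c → f (a , c)) (allFin (suc n)))

-- x, y are the values on a column of C₂ □ Cₙ, and p, q those on the preceding column.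
Dominated : ℕ → ℕ → ℕ → ℕ → Set
Dominated x y p q = (x ≡ 0 → 2 ≤ y + p) × (y ≡ 0 → 2 ≤ x + q)

dominated-≥2 : ∀ {x y p q} → Dominated x y p q → 2 ≤ (p + q) + (x + y)
dominated-≥2 {zero} {y} {p} {q} (dom₀ , _) = begin
  2           ≤⟨ dom₀ refl ⟩
  y + p       ≡⟨ +-comm y p ⟩
  p + y       ≤⟨ +-monoˡ-≤ y (m≤m+n p q) ⟩
  (p + q) + y ∎
  where open ≤-Reasoning
dominated-≥2 {suc x} {zero} {p} {q} (_ , dom₁) = begin
  2                     ≤⟨ dom₁ refl ⟩
  suc x + q             ≡⟨ +-comm (suc x) q ⟩
  q + suc x             ≤⟨ +-mono-≤ (m≤n+m q p) (m≤m+n (suc x) 0) ⟩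
  (p + q) + (suc x + 0) ∎
  where open ≤-Reasoning
dominated-≥2 {suc x} {suc y} {p} {q} _ = begin
  2                         ≤⟨ s≤s (s≤s z≤n) ⟩
  suc (suc (x + y))         ≡⟨ cong suc (+-suc x y) ⟨
  suc x + suc y             ≤⟨ m≤n+m (suc x + suc y) (p + q) ⟩
  (p + q) + (suc x + suc y) ∎
  where open ≤-Reasoning

dominated-empty : ∀ {x y p q} → Dominated x y p q → x + y ≡ 0 → 4 ≤ p + q
dominated-empty {zero} {zero} (dom₀ , dom₁) refl = +-mono-≤ (dom₀ refl) (dom₁ refl)

dominated-parity : ∀ {x y p q} → Dominated x y p q → x + y ≡ 1 → p + q ≡ 1 → p + x ≡ 1
dominated-parity {0} {p = 0} (dom₀ , _) refl refl = contradiction (dom₀ refl) λ { (s≤s ()) }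
dominated-parity {0} {p = 1} _          refl refl = refl
dominated-parity {1} {p = 0} _          refl refl = refl
dominated-parity {1} {p = 1} (_ , dom₁) refl refl = contradiction (dom₁ refl) λ { (s≤s ()) }
dominated-parity {suc (suc _)} _ () _
dominated-parity {p = suc (suc _)} _ _ ()

m+n≡2⇒n≡1 : ∀ {m n} → m + n ≡ 2 → m ≢ 0 → n ≢ 0 → n ≡ 1
m+n≡2⇒n≡1 {zero}              _  m≢0 _   = contradiction refl m≢0
m+n≡2⇒n≡1 {suc _} {zero}      _  _   n≢0 = contradiction refl n≢0
m+n≡2⇒n≡1 {1}     {1}         _  _   _   = refl
m+n≡2⇒n≡1 {1}     {suc (suc _)} ()
m+n≡2⇒n≡1 {suc (suc zero)}    {suc _} ()
m+n≡2⇒n≡1 {suc (suc (suc _))} {suc _} ()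

module LowerBound {N : ℕ} (f : Fin 2 × Fin (suc N) → ℕ)
                  (italian : IsItalianDominating (Cyc 2 □ Cyc (suc N)) f) where

  column : Fin (suc N) → ℕ
  column c = f (0F , c) + f (1F , c)

  dominated : ∀ c → Dominated (f (0F , c)) (f (1F , c)) (f (0F , cyclicPred c)) (f (1F , cyclicPred c))
  dominated c = □-italian-zero italian 0F c , □-italian-zero italian 1F c

  adjacent : Fin (suc N) → ℕ
  adjacent c = column (cyclicPred c) + column c

  adjacent-≥2 : ∀ c → 2 ≤ adjacent c
  adjacent-≥2 c = dominated-≥2 (dominated c)

  ∑-adjacent : sum adjacent ≡ 2 * weight (Cyc 2 □ Cyc (suc N)) f
  ∑-adjacent = trans (∑-cyclic-pairs column) (cong (2 *_) (sym (weight-C₂□C f)))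

  tight⇒alternating : (∀ c → adjacent c ≡ 2) → ∀ c → f (0F , cyclicPred c) + f (0F , c) ≡ 1
  tight⇒alternating tight c = dominated-parity (dominated c) (column≡1 c) (column≡1 (cyclicPred c))
    where
    column≢0 : ∀ c → column c ≢ 0
    column≢0 c empty = contradiction 4≤2 λ { (s≤s (s≤s ())) }
      where
      4≤2 : 4 ≤ 2
      4≤2 = ≤-trans (dominated-empty (dominated c) empty) (≤-trans (m≤m+n _ _) (≤-reflexive (tight c)))
    column≡1 : ∀ c → column c ≡ 1
    column≡1 c = m+n≡2⇒n≡1 (tight c) (column≢0 (cyclicPred c)) (column≢0 c)

  lower-bound : ∃[ k ] suc N ≡ 2 * k + 1 → suc N + 1 ≤ weight (Cyc 2 □ Cyc (suc N)) f
  lower-bound (k , odd) with all? (λ c → adjacent c ≟ 2)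
  ... | yes tight = contradiction even-length (even≢odd (sum row₀) k)
    where
    row₀ : Fin (suc N) → ℕ
    row₀ c = f (0F , c)
    even-length : 2 * sum row₀ ≡ suc (2 * k)
    even-length = trans (alternating⇒even row₀ (tight⇒alternating tight)) (trans odd (+-comm (2 * k) 1))
  ... | no ¬tight with ¬∀⟶∃¬ (suc N) _ (λ c → adjacent c ≟ 2) ¬tight
  ...   | c , adjacent≢2 = subst (_≤ W) (+-comm 1 (suc N)) (*-cancelˡ-< 2 (suc N) W 2n<2W)
    where
    W : ℕ
    W = weight (Cyc 2 □ Cyc (suc N)) f
    2n<2W : 2 * suc N < 2 * W
    2n<2W = begin-strict
      2 * suc N              ≡⟨ *-comm 2 (suc N) ⟩
      suc N * 2              ≡⟨ ∑-const (suc N) 2 ⟨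
      ∑[ c < suc N ] 2       <⟨ ∑-mono-< adjacent-≥2 c (≤∧≢⇒< (adjacent-≥2 c) (≢-sym adjacent≢2)) ⟩
      sum adjacent           ≡⟨ ∑-adjacent ⟩
      2 * W                  ∎
      where open ≤-Reasoning

χ-even : ℕ → ℕ
χ-even zero          = 1
χ-even (suc zero)    = 0
χ-even (suc (suc m)) = χ-even m

χ-even-≤1 : ∀ m → χ-even m ≤ 1
χ-even-≤1 zero          = s≤s z≤n
χ-even-≤1 (suc zero)    = z≤n
χ-even-≤1 (suc (suc m)) = χ-even-≤1 m

χ-even-suc : ∀ m → χ-even (suc m) + χ-even m ≡ 1
χ-even-suc zero          = refl
χ-even-suc (suc zero)    = refl
χ-even-suc (suc (suc m)) = χ-even-suc m

χ-even-suc≡0 : ∀ m → χ-even (suc m) ≡ 0 → χ-even m ≡ 1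
χ-even-suc≡0 m e = trans (cong (_+ χ-even m) (sym e)) (χ-even-suc m)

χ-even≡0 : ∀ m → χ-even m ≡ 0 → χ-even (suc m) ≡ 1
χ-even≡0 m e = trans (sym (+-identityʳ _)) (trans (cong (χ-even (suc m) +_) (sym e)) (χ-even-suc m))

-- The extra 1 at (1F, 0) is needed because n - 1 is even, so (1F, n - 1) carries 0.
row : Fin 2 → ℕ → ℕ
row 0F m       = χ-even m
row 1F zero    = 1
row 1F (suc m) = χ-even m

row-≤1 : ∀ a m → row a m ≤ 1
row-≤1 0F m       = χ-even-≤1 m
row-≤1 1F zero    = s≤s z≤n
row-≤1 1F (suc m) = χ-even-≤1 m

row-dominated : ∀ a m → row a (suc m) ≡ 0 → row (cyclicPred a) (suc m) ≡ 1 × row a m ≡ 1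
row-dominated 0F m       r≡0 = χ-even-suc≡0 m r≡0 , χ-even-suc≡0 m r≡0
row-dominated 1F zero    r≡0 = χ-even≡0 0 r≡0 , refl
row-dominated 1F (suc m) r≡0 = χ-even≡0 (suc m) r≡0 , χ-even-suc≡0 m r≡0

cyclicPred₂-≢ : ∀ (a : Fin 2) → cyclicPred a ≢ a
cyclicPred₂-≢ 0F ()
cyclicPred₂-≢ 1F ()

module UpperBound (N : ℕ) where

  witness : Fin 2 × Fin (suc N) → ℕ
  witness (a , c) = row a (toℕ c)

  witness-italian : IsItalianDominating (Cyc 2 □ Cyc (suc N)) witness
  proj₁ witness-italian (a , c) = ≤-trans (row-≤1 a (toℕ c)) (n≤1+n 1)
  proj₂ witness-italian (0F , zero) ()
  proj₂ witness-italian (1F , zero) ()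
  proj₂ witness-italian (a , suc c) w≡0 =
    inj₁ ( (cyclicPred a , suc c) , (a , inject₁ c)
         , (λ eq → cyclicPred₂-≢ a (cong proj₁ eq))
         , □-arc-cyclicPred₁ a (suc c) , □-arc-cyclicPred₂ a (suc c)
         , proj₁ values , subst (λ m → row a m ≡ 1) (sym (toℕ-inject₁ c)) (proj₂ values) )
    where
    values : row (cyclicPred a) (suc (toℕ c)) ≡ 1 × row a (toℕ c) ≡ 1
    values = row-dominated a (toℕ c) w≡0

  witness-weight : weight (Cyc 2 □ Cyc (suc N)) witness ≡ suc N + 1
  witness-weight = begin
    weight (Cyc 2 □ Cyc (suc N)) witness                  ≡⟨ weight-C₂□C witness ⟩
    2 + ∑[ c < N ] (χ-even (suc (toℕ c)) + χ-even (toℕ c)) ≡⟨ cong (2 +_) (sum-cong-≗ {N} (χ-even-suc ∘ toℕ)) ⟩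
    2 + ∑[ c < N ] 1                                      ≡⟨ cong (2 +_) (trans (∑-const N 1) (*-identityʳ N)) ⟩
    2 + N                                                 ≡⟨ +-comm 1 (suc N) ⟩
    suc N + 1                                             ∎
    where open ≡-Reasoning

theorem2p2 : (n : ℕ) .{{_ : NonZero n}} → 3 ≤ n → ∃[ k ] n ≡ 2 * k + 1 →
    ItalianDominationNumber (Cyc 2 □ Cyc n) (n + 1)
theorem2p2 (suc N) _ odd =
  (witness , witness-italian , witness-weight) , λ f italian → LowerBound.lower-bound f italian odd
  where open UpperBound N
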